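{- Let $m=2^n$ with $n>2$, let $r\in\{1,2,\ldots,\frac m2-1\}$, and let $S=\{\frac m2-r,\frac m2-(r-1),\ldots,\frac m2-1,\frac m2\}$. Then the circulant graph $G=C_m(S)$ does not admit an open XOR-magic labeling.
   Context: For $m\ge 4$ and $S\subseteq\{1,2,\ldots,\lfloor m/2\rfloor\}$, the circulant graph $C_m(S)$ has vertices $x_0,\ldots,x_{m-1}$, and distinct $x_i,x_j$ are adjacent if and only if $|i-j|\in\{s,\,m-s : s\in S\}$. For a vertex $x$, $N(x)$ is its set of neighbours. An open XOR-magic labeling of a graph $G=(V,E)$ with $|V|=2^n$ is a bijection $\ell:V\to(\mathbb{Z}_2)^n$ such that $\sum_{y\in N(x)}\ell(y)$ is the zero vector of $(\mathbb{Z}_2)^n$ for every $x\in V$. -}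

module Defs where

open import Data.Nat using (ℕ; zero; suc; _+_; _∸_; _^_; _≡ᵇ_)
open import Data.Nat.Properties using ()
open import Data.Bool using (Bool; true; false; _∧_; _∨_; _xor_; not; if_then_else_)
open import Data.Fin using (Fin; toℕ)
open import Data.List using (List; []; _∷_; foldr; map; upTo)
open import Data.Bool.ListAction using (any)
open import Data.Vec using (Vec; replicate; zipWith)
open import Data.Product using (Σ)
open import Function.Bundles using (_⤖_; Bijection)
open import Relation.Binary.PropositionalEquality using (_≡_)
open import Data.List using (allFin) public

absDiff : ℕ → ℕ → ℕ
absDiff i j = (i ∸ j) + (j ∸ i)

circAdj : (m : ℕ) → List ℕ → Fin m → Fin m → Bool
circAdj m S i j =
  not (toℕ i ≡ᵇ toℕ j) ∧
  any (λ s → (absDiff (toℕ i) (toℕ j) ≡ᵇ s) ∨ (absDiff (toℕ i) (toℕ j) ≡ᵇ (m ∸ s))) S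

Z2^ : ℕ → Set
Z2^ n = Vec Bool n

zero2 : (n : ℕ) → Z2^ n
zero2 n = replicate n false

_⊕_ : {n : ℕ} → Z2^ n → Z2^ n → Z2^ n
_⊕_ = zipWith _xor_

nbrSum : (m : ℕ) (S : List ℕ) {n : ℕ} → (Fin m → Z2^ n) → Fin m → Z2^ n
nbrSum m S {n} ℓ x =
  foldr (λ y acc → if circAdj m S x y then ℓ y ⊕ acc else acc) (zero2 n) (allFin m)

OpenXORMagic : (n : ℕ) → List ℕ → Set
OpenXORMagic n S =
  Σ (Fin (2 ^ n) ⤖ Z2^ n) λ ℓ →
    (x : Fin (2 ^ n)) → nbrSum (2 ^ n) S (Bijection.to ℓ) x ≡ zero2 n

-- S = { m/2 - r, m/2 - (r-1), ..., m/2 - 1, m/2 } with h = m/2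
intervalS : (h r : ℕ) → List ℕ
intervalS h r = map (λ k → h ∸ k) (upTo (suc r))

{-# OPTIONS --safe #-}
-- Write m = 2h and a = h − r − 1. The distances realised by S ∪ (m − S) form the interval
-- [a + 1, h + r], so N(x_0) = {x_t : a + 1 ≤ t ≤ h + r} and N(x_{m−1}) = {x_t : a ≤ t ≤ h + r − 1}.
-- These differ exactly in x_a and x_{h+r}, so adding the two vanishing neighbourhood sums in
-- (ℤ₂)ⁿ leaves ℓ(x_a) + ℓ(x_{h+r}) = 0, i.e. ℓ(x_a) = ℓ(x_{h+r}), contradicting injectivity.
module Submission where

open import Defs
open import Data.Bool using (Bool; true; false; _∧_; _∨_; _xor_; not; if_then_else_; T)
open import Data.Bool.Properties
  using (T-≡; T-∧; T-∨; ⇔→≡; ∧-comm; xor-assoc; xor-comm; xor-identityˡ; xor-identityʳ; xor-same)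
open import Data.Fin using (Fin; zero; suc; toℕ; fromℕ; fromℕ<)
open import Data.Fin.Properties using (toℕ-fromℕ; toℕ<n; fromℕ<-injective)
open import Data.List using (List; []; _∷_; foldr; map; tabulate)
open import Data.Bool.ListAction using (any)
open import Data.List.Properties using (map-tabulate)
open import Data.List.Membership.Propositional using (find; lose)
open import Data.List.Membership.Propositional.Properties using (∈-upTo⁺; ∈-upTo⁻)
open import Data.List.Relation.Unary.Any.Properties using (any⁺; any⁻; map⁺; map⁻)
open import Data.Nat
  using (ℕ; zero; suc; _+_; _∸_; _^_; _≤_; _<_; _≤ᵇ_; _<ᵇ_; _≡ᵇ_; s≤s; s≤s⁻¹; _≤?_)
open import Data.Nat.Properties
open import Data.Nat.Solver using (module +-*-Solver)
open import Data.Product using (∃-syntax; _×_; _,_)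
open import Data.Sum as Sum using (_⊎_; inj₁; inj₂)
open import Data.Vec using ([]; _∷_)
open import Data.Vec.Properties using (zipWith-assoc; zipWith-comm; zipWith-identityˡ; zipWith-identityʳ)
open import Function using (_∘_; id; _⇔_; mk⇔; Equivalence; Injective; Bijection)
open import Function.Properties.Equivalence using () renaming (sym to ⇔-sym; trans to ⇔-trans)
open import Relation.Binary.PropositionalEquality
open import Relation.Nullary using (¬_; yes; no)

⊕-self : ∀ {k} (v : Z2^ k) → v ⊕ v ≡ zero2 k
⊕-self []      = refl
⊕-self (b ∷ v) = cong₂ _∷_ (xor-same b) (⊕-self v)

module _ {k : ℕ} where
  open ≡-Reasoning

  ⊕-assoc : (u v w : Z2^ k) → (u ⊕ v) ⊕ w ≡ u ⊕ (v ⊕ w)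
  ⊕-assoc = zipWith-assoc xor-assoc

  ⊕-comm : (u v : Z2^ k) → u ⊕ v ≡ v ⊕ u
  ⊕-comm = zipWith-comm xor-comm

  ⊕-identityˡ : (v : Z2^ k) → zero2 k ⊕ v ≡ v
  ⊕-identityˡ = zipWith-identityˡ xor-identityˡ

  ⊕-identityʳ : (v : Z2^ k) → v ⊕ zero2 k ≡ v
  ⊕-identityʳ = zipWith-identityʳ xor-identityʳ

  ⊕-leftComm : (u v w : Z2^ k) → u ⊕ (v ⊕ w) ≡ v ⊕ (u ⊕ w)
  ⊕-leftComm u v w = begin
    u ⊕ (v ⊕ w)  ≡⟨ ⊕-assoc u v w ⟨
    (u ⊕ v) ⊕ w  ≡⟨ cong (_⊕ w) (⊕-comm u v) ⟩
    (v ⊕ u) ⊕ w  ≡⟨ ⊕-assoc v u w ⟩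
    v ⊕ (u ⊕ w)  ∎

  ⊕-interchange : (u v w x : Z2^ k) → (u ⊕ v) ⊕ (w ⊕ x) ≡ (u ⊕ w) ⊕ (v ⊕ x)
  ⊕-interchange u v w x = begin
    (u ⊕ v) ⊕ (w ⊕ x)  ≡⟨ ⊕-assoc u v (w ⊕ x) ⟩
    u ⊕ (v ⊕ (w ⊕ x))  ≡⟨ cong (u ⊕_) (⊕-leftComm v w x) ⟩
    u ⊕ (w ⊕ (v ⊕ x))  ≡⟨ ⊕-assoc u w (v ⊕ x) ⟨
    (u ⊕ w) ⊕ (v ⊕ x)  ∎

  ⊕≡zero⇒≡ : (u v : Z2^ k) → u ⊕ v ≡ zero2 k → u ≡ v
  ⊕≡zero⇒≡ u v u⊕v≡0 = begin
    u                ≡⟨ ⊕-identityʳ u ⟨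
    u ⊕ zero2 k      ≡⟨ cong (u ⊕_) (⊕-self v) ⟨
    u ⊕ (v ⊕ v)      ≡⟨ ⊕-assoc u v v ⟨
    (u ⊕ v) ⊕ v      ≡⟨ cong (_⊕ v) u⊕v≡0 ⟩
    zero2 k ⊕ v      ≡⟨ ⊕-identityˡ v ⟩
    v                ∎

maskedSum : ∀ {A : Set} {k} → (A → Z2^ k) → (A → Bool) → List A → Z2^ k
maskedSum {k = k} ℓ p = foldr (λ y acc → if p y then ℓ y ⊕ acc else acc) (zero2 k)

module _ {A : Set} {k : ℕ} (ℓ : A → Z2^ k) where

  maskedSum-false : (ys : List A) → maskedSum ℓ (λ _ → false) ys ≡ zero2 k
  maskedSum-false []       = refl
  maskedSum-false (_ ∷ ys) = maskedSum-false ys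

  maskedSum-cong : ∀ {p q : A → Bool} → (∀ y → p y ≡ q y) → (ys : List A) →
                   maskedSum ℓ p ys ≡ maskedSum ℓ q ys
  maskedSum-cong p≗q []       = refl
  maskedSum-cong p≗q (y ∷ ys) =
    cong₂ (λ b acc → if b then ℓ y ⊕ acc else acc) (p≗q y) (maskedSum-cong p≗q ys)

  maskedSum-xor : (p q : A → Bool) (ys : List A) →
                  maskedSum ℓ p ys ⊕ maskedSum ℓ q ys ≡ maskedSum ℓ (λ y → p y xor q y) ys
  maskedSum-xor p q []       = ⊕-self (zero2 k)
  maskedSum-xor p q (y ∷ ys) with p y | q y
  ... | true  | true  = begin
    (ℓ y ⊕ P) ⊕ (ℓ y ⊕ Q)  ≡⟨ ⊕-interchange (ℓ y) P (ℓ y) Q ⟩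
    (ℓ y ⊕ ℓ y) ⊕ (P ⊕ Q)  ≡⟨ cong (_⊕ (P ⊕ Q)) (⊕-self (ℓ y)) ⟩
    zero2 k ⊕ (P ⊕ Q)      ≡⟨ ⊕-identityˡ (P ⊕ Q) ⟩
    P ⊕ Q                  ≡⟨ maskedSum-xor p q ys ⟩
    _                      ∎
    where
    open ≡-Reasoning
    P Q : Z2^ k
    P = maskedSum ℓ p ys
    Q = maskedSum ℓ q ys
  ... | true  | false = trans (⊕-assoc (ℓ y) _ _) (cong (ℓ y ⊕_) (maskedSum-xor p q ys))
  ... | false | true  = trans (⊕-leftComm _ (ℓ y) _) (cong (ℓ y ⊕_) (maskedSum-xor p q ys))
  ... | false | false = maskedSum-xor p q ys

maskedSum-map : ∀ {A B : Set} {k} (ℓ : B → Z2^ k) (p : B → Bool) (f : A → B) (ys : List A) →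
                maskedSum ℓ p (map f ys) ≡ maskedSum (ℓ ∘ f) (p ∘ f) ys
maskedSum-map ℓ p f []       = refl
maskedSum-map ℓ p f (y ∷ ys) =
  cong (λ acc → if p (f y) then ℓ (f y) ⊕ acc else acc) (maskedSum-map ℓ p f ys)

maskedSum-tabulate-suc : ∀ {m k} (ℓ : Fin (suc m) → Z2^ k) (p : Fin (suc m) → Bool) →
                         maskedSum ℓ p (tabulate suc) ≡ maskedSum (ℓ ∘ suc) (p ∘ suc) (allFin m)
maskedSum-tabulate-suc ℓ p =
  trans (cong (maskedSum ℓ p) (sym (map-tabulate id suc))) (maskedSum-map ℓ p suc (allFin _))

maskedSum-toℕ≡ᵇ : ∀ {m k} (ℓ : Fin m → Z2^ k) {c} (c<m : c < m) →
                  maskedSum ℓ (λ y → toℕ y ≡ᵇ c) (allFin m) ≡ ℓ (fromℕ< c<m)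
maskedSum-toℕ≡ᵇ {suc m} ℓ {zero} _ = begin
  ℓ zero ⊕ maskedSum ℓ (λ y → toℕ y ≡ᵇ 0) (tabulate suc)  ≡⟨ cong (ℓ zero ⊕_) tail≡0 ⟩
  ℓ zero ⊕ zero2 _                                       ≡⟨ ⊕-identityʳ (ℓ zero) ⟩
  ℓ zero                                                 ∎
  where
  open ≡-Reasoning
  tail≡0 : maskedSum ℓ (λ y → toℕ y ≡ᵇ 0) (tabulate suc) ≡ zero2 _
  tail≡0 = trans (maskedSum-tabulate-suc ℓ _) (maskedSum-false (ℓ ∘ suc) (allFin m))
maskedSum-toℕ≡ᵇ {suc m} ℓ {suc c} (s≤s c<m) =
  trans (maskedSum-tabulate-suc ℓ _) (maskedSum-toℕ≡ᵇ (ℓ ∘ suc) c<m)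

zeroSums⇒ℓ-≡-on-symmetricDifference :
  ∀ {m k} (ℓ : Fin m → Z2^ k) {p q : Fin m → Bool} {a b} (a<m : a < m) (b<m : b < m) →
  (∀ y → p y xor q y ≡ (toℕ y ≡ᵇ a) xor (toℕ y ≡ᵇ b)) →
  maskedSum ℓ p (allFin m) ≡ zero2 k → maskedSum ℓ q (allFin m) ≡ zero2 k →
  ℓ (fromℕ< a<m) ≡ ℓ (fromℕ< b<m)
zeroSums⇒ℓ-≡-on-symmetricDifference {m} {k} ℓ {p} {q} {a} {b} a<m b<m p△q Σp≡0 Σq≡0 =
  ⊕≡zero⇒≡ _ _ (begin
    ℓ (fromℕ< a<m) ⊕ ℓ (fromℕ< b<m)
      ≡⟨ cong₂ _⊕_ (maskedSum-toℕ≡ᵇ ℓ a<m) (maskedSum-toℕ≡ᵇ ℓ b<m) ⟨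
    Σ (λ y → toℕ y ≡ᵇ a) ⊕ Σ (λ y → toℕ y ≡ᵇ b)
      ≡⟨ maskedSum-xor ℓ _ _ (allFin m) ⟩
    Σ (λ y → (toℕ y ≡ᵇ a) xor (toℕ y ≡ᵇ b))
      ≡⟨ maskedSum-cong ℓ p△q (allFin m) ⟨
    Σ (λ y → p y xor q y)
      ≡⟨ maskedSum-xor ℓ p q (allFin m) ⟨
    Σ p ⊕ Σ q
      ≡⟨ cong₂ _⊕_ Σp≡0 Σq≡0 ⟩
    zero2 k ⊕ zero2 k
      ≡⟨ ⊕-self (zero2 k) ⟩
    zero2 k ∎)
  where
  open ≡-Reasoning
  Σ : (Fin m → Bool) → Z2^ k
  Σ s = maskedSum ℓ s (allFin m)

T-injective : ∀ {x y} → T x ⇔ T y → x ≡ y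
T-injective x⇔y = ⇔→≡ {z = true} (⇔-trans (⇔-sym T-≡) (⇔-trans x⇔y T-≡))

≤ᵇ-cong : ∀ {m n m′ n′} → (m ≤ n ⇔ m′ ≤ n′) → (m ≤ᵇ n) ≡ (m′ ≤ᵇ n′)
≤ᵇ-cong {m} {n} {m′} {n′} ≤⇔≤ = T-injective (mk⇔
  (≤⇒≤ᵇ ∘ Equivalence.to ≤⇔≤ ∘ ≤ᵇ⇒≤ m n)
  (≤⇒≤ᵇ ∘ Equivalence.from ≤⇔≤ ∘ ≤ᵇ⇒≤ m′ n′))

+≡+⇒≤⇔≤ : ∀ {t u x y} → t + u ≡ x + y → (t ≤ x ⇔ y ≤ u)
+≡+⇒≤⇔≤ {t} {u} {x} {y} t+u≡x+y = mk⇔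
  (λ t≤x → +-cancelˡ-≤ x y u (subst (_≤ x + u) t+u≡x+y (+-monoˡ-≤ u t≤x)))
  (λ y≤u → +-cancelʳ-≤ u t x (subst (_≤ x + u) (sym t+u≡x+y) (+-monoʳ-≤ x y≤u)))

inRange : ℕ → ℕ → ℕ → Bool
inRange lo hi d = (lo ≤ᵇ d) ∧ (d ≤ᵇ hi)

T-inRange : ∀ {lo hi d} → T (inRange lo hi d) ⇔ (lo ≤ d × d ≤ hi)
T-inRange {lo} {hi} {d} = mk⇔
  (λ t → let lo≤ᵇd , d≤ᵇhi = Equivalence.to T-∧ t in ≤ᵇ⇒≤ lo d lo≤ᵇd , ≤ᵇ⇒≤ d hi d≤ᵇhi)
  (λ (lo≤d , d≤hi) → Equivalence.from T-∧ (≤⇒≤ᵇ lo≤d , ≤⇒≤ᵇ d≤hi))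

inRange-suc : ∀ lo hi d → inRange (suc lo) (suc hi) (suc d) ≡ inRange lo hi d
inRange-suc zero     hi zero    = refl
inRange-suc zero     hi (suc d) = refl
inRange-suc (suc lo) hi zero    = refl
inRange-suc (suc lo) hi (suc d) = refl

<ᵇ-xor-<ᵇ-suc : ∀ t e → (t <ᵇ e) xor (t <ᵇ suc e) ≡ (t ≡ᵇ e)
<ᵇ-xor-<ᵇ-suc zero    zero    = refl
<ᵇ-xor-<ᵇ-suc zero    (suc e) = refl
<ᵇ-xor-<ᵇ-suc (suc t) zero    = refl
<ᵇ-xor-<ᵇ-suc (suc t) (suc e) = <ᵇ-xor-<ᵇ-suc t e

inRange-xor-inRange-suc : ∀ {a e} t → a ≤ e →
  inRange a e t xor inRange (suc a) (suc e) t ≡ (t ≡ᵇ a) xor (t ≡ᵇ suc e)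
inRange-xor-inRange-suc {zero}  {e}     zero    _          = refl
inRange-xor-inRange-suc {zero}  {e}     (suc t) _          = <ᵇ-xor-<ᵇ-suc t e
inRange-xor-inRange-suc {suc a} {e}     zero    _          = refl
inRange-xor-inRange-suc {suc a} {suc e} (suc t) (s≤s a≤e) =
  trans (cong₂ _xor_ (inRange-suc a e t) (inRange-suc (suc a) (suc e) t))
        (inRange-xor-inRange-suc t a≤e)

inRange-reflect : ∀ {a e t u} → t + u ≡ a + suc e → inRange (suc a) (suc e) u ≡ inRange a e t
inRange-reflect {a} {e} {t} {u} t+u≡a+1+e = begin
  (suc a ≤ᵇ u) ∧ (u ≤ᵇ suc e)  ≡⟨ cong₂ _∧_ (≤ᵇ-cong lower) (≤ᵇ-cong upper) ⟨
  (t ≤ᵇ e) ∧ (a ≤ᵇ t)          ≡⟨ ∧-comm (t ≤ᵇ e) (a ≤ᵇ t) ⟩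
  (a ≤ᵇ t) ∧ (t ≤ᵇ e)          ∎
  where
  open ≡-Reasoning
  lower : t ≤ e ⇔ suc a ≤ u
  lower = +≡+⇒≤⇔≤ (trans t+u≡a+1+e (trans (+-suc a e) (+-comm (suc a) e)))
  upper : a ≤ t ⇔ u ≤ suc e
  upper = +≡+⇒≤⇔≤ (sym t+u≡a+1+e)

connects : ℕ → List ℕ → ℕ → Bool
connects m S d = any (λ s → (d ≡ᵇ s) ∨ (d ≡ᵇ (m ∸ s))) S

h+h∸[h∸k]≡h+k : ∀ {h k} → k ≤ h → (h + h) ∸ (h ∸ k) ≡ h + k
h+h∸[h∸k]≡h+k {h} {k} k≤h = trans (+-∸-assoc h (m∸n≤m h k)) (cong (h +_) (m∸[m∸n]≡n k≤h))

T-connects-intervalS : ∀ {h r d} → r ≤ h →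
  T (connects (h + h) (intervalS h r) d) ⇔ (∃[ k ] k ≤ r × (d ≡ h ∸ k ⊎ d ≡ h + k))
T-connects-intervalS {h} {r} {d} r≤h = mk⇔ to from
  where
  P : ℕ → Bool
  P s = (d ≡ᵇ s) ∨ (d ≡ᵇ ((h + h) ∸ s))

  to : T (any P (intervalS h r)) → ∃[ k ] k ≤ r × (d ≡ h ∸ k ⊎ d ≡ h + k)
  to t with k , k∈ , Pk ← find (map⁻ (any⁻ P _ t)) = k , k≤r , Sum.map
      (≡ᵇ⇒≡ d _)
      (λ d≡ᵇ → trans (≡ᵇ⇒≡ d _ d≡ᵇ) (h+h∸[h∸k]≡h+k (≤-trans k≤r r≤h)))
      (Equivalence.to T-∨ Pk)
    where
    k≤r : k ≤ r
    k≤r = s≤s⁻¹ (∈-upTo⁻ k∈)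

  from : (∃[ k ] k ≤ r × (d ≡ h ∸ k ⊎ d ≡ h + k)) → T (any P (intervalS h r))
  from (k , k≤r , d≡) = any⁺ P (map⁺ (lose (∈-upTo⁺ (s≤s k≤r)) (Equivalence.from T-∨ (Sum.map
      (≡⇒≡ᵇ d _)
      (λ d≡h+k → ≡⇒≡ᵇ d _ (trans d≡h+k (sym (h+h∸[h∸k]≡h+k (≤-trans k≤r r≤h)))))
      d≡))))

h±k⇔bounds : ∀ {c r d} →
  (∃[ k ] k ≤ r × (d ≡ (c + r) ∸ k ⊎ d ≡ (c + r) + k)) ⇔ (c ≤ d × d ≤ (c + r) + r)
h±k⇔bounds {c} {r} {d} = mk⇔ to from
  where
  to : (∃[ k ] k ≤ r × (d ≡ (c + r) ∸ k ⊎ d ≡ (c + r) + k)) → c ≤ d × d ≤ (c + r) + r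
  to (k , k≤r , inj₁ refl) =
    m+n≤o⇒m≤o∸n c (+-monoʳ-≤ c k≤r) , ≤-trans (m∸n≤m (c + r) k) (m≤m+n (c + r) r)
  to (k , k≤r , inj₂ refl) =
    ≤-trans (m≤m+n c r) (m≤m+n (c + r) k) , +-monoʳ-≤ (c + r) k≤r

  from : c ≤ d × d ≤ (c + r) + r → ∃[ k ] k ≤ r × (d ≡ (c + r) ∸ k ⊎ d ≡ (c + r) + k)
  from (c≤d , d≤h+r) with d ≤? c + r
  ... | yes d≤h = (c + r) ∸ d , m≤n+o⇒m∸n≤o (c + r) d (+-monoˡ-≤ r c≤d) , inj₁ (sym (m∸[m∸n]≡n d≤h))
  ... | no  d≰h = d ∸ (c + r) , m≤n+o⇒m∸n≤o d (c + r) d≤h+r , inj₂ (sym (m+[n∸m]≡n (<⇒≤ (≰⇒> d≰h))))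

connects-intervalS : ∀ {c r h d} → c + r ≡ h → connects (h + h) (intervalS h r) d ≡ inRange c (h + r) d
connects-intervalS {c} {r} refl =
  T-injective (⇔-trans (T-connects-intervalS (m≤n+m r c)) (⇔-trans h±k⇔bounds (⇔-sym T-inRange)))

not-≡ᵇ-∧-inRange-absDiff : ∀ {lo hi} u v →
  not (u ≡ᵇ v) ∧ inRange (suc lo) hi (absDiff u v) ≡ inRange (suc lo) hi (absDiff u v)
not-≡ᵇ-∧-inRange-absDiff zero    zero    = refl
not-≡ᵇ-∧-inRange-absDiff zero    (suc v) = refl
not-≡ᵇ-∧-inRange-absDiff (suc u) zero    = refl
not-≡ᵇ-∧-inRange-absDiff (suc u) (suc v) = not-≡ᵇ-∧-inRange-absDiff u v

circAdj-intervalS : ∀ {a r h} → suc a + r ≡ h → (i j : Fin (h + h)) →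
  circAdj (h + h) (intervalS h r) i j ≡ inRange (suc a) (h + r) (absDiff (toℕ i) (toℕ j))
circAdj-intervalS h≡ i j =
  trans (cong (not (toℕ i ≡ᵇ toℕ j) ∧_) (connects-intervalS {d = absDiff (toℕ i) (toℕ j)} h≡))
        (not-≡ᵇ-∧-inRange-absDiff (toℕ i) (toℕ j))

absDiff-zeroˡ : ∀ t → absDiff 0 t ≡ t
absDiff-zeroˡ t = cong (_+ t) (0∸n≡0 t)

absDiff-≥ : ∀ {m t} → t ≤ m → absDiff m t ≡ m ∸ t
absDiff-≥ {m} {t} t≤m = trans (cong ((m ∸ t) +_) (m≤n⇒m∸n≡0 t≤m)) (+-identityʳ (m ∸ t))

-- For m = h + h: a = h − r − 1, e = h + r − 1, and M = m − 1 is the last vertex.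
module IntervalCirculant (r a : ℕ) where
  open ≡-Reasoning

  h e M : ℕ
  h = suc (r + a)
  e = r + a + r
  M = r + a + suc (r + a)

  S : List ℕ
  S = intervalS h r

  a≤e : a ≤ e
  a≤e = ≤-trans (m≤n+m a r) (m≤m+n (r + a) r)

  M≡a+1+e : M ≡ a + suc e
  M≡a+1+e = solve 2 (λ r a → r :+ a :+ (con 1 :+ (r :+ a)) := a :+ (con 1 :+ (r :+ a :+ r))) refl r a
    where open +-*-Solver

  a<h+h : a < h + h
  a<h+h = s≤s (subst (a ≤_) (sym M≡a+1+e) (m≤m+n a (suc e)))

  1+e<h+h : suc e < h + h
  1+e<h+h = s≤s (subst (suc e ≤_) (sym M≡a+1+e) (m≤n+m (suc e) a))

  circAdj-last-xor-circAdj-first : ∀ y → circAdj (h + h) S (fromℕ M) y xor circAdj (h + h) S zero y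
                                    ≡ (toℕ y ≡ᵇ a) xor (toℕ y ≡ᵇ suc e)
  circAdj-last-xor-circAdj-first y = begin
    circAdj (h + h) S (fromℕ M) y xor circAdj (h + h) S zero y
      ≡⟨ cong₂ _xor_ (circAdj-intervalS h≡ (fromℕ M) y) (circAdj-intervalS h≡ zero y) ⟩
    I (absDiff (toℕ (fromℕ M)) t) xor I (absDiff 0 t)
      ≡⟨ cong₂ (λ u v → I u xor I v) (trans (cong (λ x → absDiff x t) (toℕ-fromℕ M)) (absDiff-≥ t≤M))
                                     (absDiff-zeroˡ t) ⟩
    I (M ∸ t) xor I t
      ≡⟨ cong (_xor I t) (inRange-reflect (trans (m+[n∸m]≡n t≤M) M≡a+1+e)) ⟩
    inRange a e t xor I t
      ≡⟨ inRange-xor-inRange-suc t a≤e ⟩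
    (t ≡ᵇ a) xor (t ≡ᵇ suc e) ∎
    where
    h≡ : suc a + r ≡ h
    h≡ = cong suc (+-comm a r)
    I : ℕ → Bool
    I = inRange (suc a) (suc e)
    t : ℕ
    t = toℕ y
    t≤M : t ≤ M
    t≤M = s≤s⁻¹ (toℕ<n y)

  noInjectiveZeroSumLabelling : ∀ {k} (ℓ : Fin (h + h) → Z2^ k) → Injective _≡_ _≡_ ℓ →
                                ¬ (∀ x → nbrSum (h + h) S ℓ x ≡ zero2 k)
  noInjectiveZeroSumLabelling ℓ ℓ-injective zeroSums = <⇒≢ (s≤s a≤e) a≡1+e
    where
    a≡1+e : a ≡ suc e
    a≡1+e = fromℕ<-injective a (suc e) a<h+h 1+e<h+h (ℓ-injective
      (zeroSums⇒ℓ-≡-on-symmetricDifference ℓ a<h+h 1+e<h+h circAdj-last-xor-circAdj-first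
        (zeroSums (fromℕ M)) (zeroSums zero)))

intervalCirculant-noInjectiveZeroSumLabelling :
  ∀ {m h r k} → m ≡ h + h → r < h → (ℓ : Fin m → Z2^ k) → Injective _≡_ _≡_ ℓ →
  ¬ (∀ x → nbrSum m (intervalS h r) ℓ x ≡ zero2 k)
intervalCirculant-noInjectiveZeroSumLabelling {r = r} refl r<h
  with a , refl ← m≤n⇒∃[o]m+o≡n r<h = IntervalCirculant.noInjectiveZeroSumLabelling r a

corollary1 : (n r : ℕ) → 2 < n → 1 ≤ r → r ≤ 2 ^ (n ∸ 1) ∸ 1 →
    ¬ OpenXORMagic n (intervalS (2 ^ (n ∸ 1)) r)
corollary1 (suc n) r _ _ r≤2^n∸1 (ℓ , zeroSums) =
  intervalCirculant-noInjectiveZeroSumLabelling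
    (cong (2 ^ n +_) (+-identityʳ (2 ^ n)))
    (m≤pred[n]⇒suc[m]≤n {{m^n≢0 2 n}} r≤2^n∸1)
    (Bijection.to ℓ) (Bijection.injective ℓ) zeroSums
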